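{- Suppose that for every integer $k\ge1$ and every $t\in\{1,\ldots,2^k-2\}$ one has $\lvert S_{t,k}\rvert\le 2^{k-1}$. Then for every nonnegative integer $t$ we have $c_t>1/2$ and $\tilde c_t\le 1/2$.
   Context: For a nonnegative integer $n$, $w(n)$ denotes the number of $1$s in the binary expansion of $n$. For $k\ge1$ and $t\in\{1,\ldots,2^k-2\}$, $S_{t,k}=\{(a,b)\in\{0,\ldots,2^k-2\}^2: a+b\equiv t \pmod{2^k-1},\ w(a)+w(b)<k\}$. For a nonnegative integer $t$, $c_t$ denotes the asymptotic density of $\{n\in\mathbb N: w(n+t)\ge w(n)\}$ and $\tilde c_t$ the asymptotic density of $\{n\in\mathbb N: w(n+t)>w(n)\}$ (these densities exist). -}

module Defs where

open import Data.Nat using (ℕ; zero; suc; _+_; _*_; _∸_; _^_; _≤_; _<_; _≤?_; _<?_; NonZero; >-nonZero; s≤s)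
open import Data.Nat.Properties using (m^n>0; m<n⇒0<n∸m; +-mono-≤; ≤-trans; m≤m+n; _≟_)
open import Data.Nat.DivMod using (_%_; _/_)
open import Data.List using (List; length; filter; upTo; concatMap; map)
open import Data.Product using (_×_; _,_; proj₁; proj₂)
open import Relation.Nullary using (Dec)
open import Relation.Nullary.Decidable using (_×-dec_)
open import Relation.Binary.PropositionalEquality using (_≡_)

-- Number of 1s in the binary expansion, by recursion with fuel;
-- fuel n suffices since n has at most n binary digits.
wAux : ℕ → ℕ → ℕ
wAux zero    n = 0
wAux (suc f) n = n % 2 + wAux f (n / 2)

w : ℕ → ℕ
w n = wAux n n

pow-1-nonZero : ∀ j → NonZero (2 ^ suc j ∸ 1)
pow-1-nonZero j = >-nonZero (m<n⇒0<n∸m (+-mono-≤ (m^n>0 2 j) (≤-trans (m^n>0 2 j) (m≤m+n _ _))))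

-- |S_{t,k}| for k = suc j (k ≥ 1):
-- pairs (a,b) ∈ {0,…,2^k-2}² with a+b ≡ t (mod 2^k-1) and w(a)+w(b) < k.
SCard : (j t : ℕ) → ℕ
SCard j t = length (filter (λ p → (((proj₁ p + proj₂ p) % M) {{pow-1-nonZero j}} ≟ t % M)
                                   ×-dec (w (proj₁ p) + w (proj₂ p) <? suc j))
                           pairs)
  where
  M : ℕ
  M = 2 ^ suc j ∸ 1
  instance
    _ : NonZero M
    _ = pow-1-nonZero j
  range : List ℕ
  range = upTo M
  pairs : List (ℕ × ℕ)
  pairs = concatMap (λ a → map (λ b → (a , b)) range) range

countGE : (t N : ℕ) → ℕ
countGE t N = length (filter (λ n → w n ≤? w (n + t)) (upTo N))

countGT : (t N : ℕ) → ℕ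
countGT t N = length (filter (λ n → w n <? w (n + t)) (upTo N))

-- Write k = j + 1, M = 2^k − 1 and cut ℕ into blocks of length 2^k. If r + t < 2^k then
-- w(q·2^k + r + t) − w(q·2^k + r) = w(r + t) − w(r), so on the offsets r < L := M − t every
-- block repeats the first one, and the remaining t + 1 offsets are bounded trivially (offset L
-- is never a descent, as L + t = M is all ones). Since w x + w (M − x) = k, an ascent a < L
-- yields (a, L − a) ∈ S_{L,k}, and a descent n yields (n + t, M − n) ∈ S_{t,k}, disjoint from
-- the pairs (a, t − a), a ≤ t, when t < k. So the hypothesis allows at most 2^j + t + 1 ascents
-- and at most 2^j − 1 descents per block: taking j = t keeps the density of descents strictly
-- below 1/2, and letting j → ∞ gives ascent density at most 1/2.

module Submission where

open import Defs
open import Data.Nat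
open import Data.Nat.Properties
open import Data.Nat.DivMod
open import Data.Nat.Divisibility using (divides-refl)
open import Data.Nat.Tactic.RingSolver using (solve-∀; solve)
open import Data.List using (List; []; _∷_; _++_; length; filter; applyUpTo; upTo; concatMap; map)
open import Data.List.Properties using (filter-++; length-++; filter-some)
open import Data.List.Membership.Propositional using (_∈_; lose)
open import Data.List.Membership.Propositional.Properties using (∈-upTo⁺; ∈-upTo⁻)
open import Data.List.Relation.Unary.Any using (Any; here; there)
import Data.List.Relation.Unary.Any.Properties as Any
import Algebra.Properties.CommutativeSemigroup +-commutativeSemigroup as +-CS
import Algebra.Properties.CommutativeSemigroup *-commutativeSemigroup as *-CS
open import Data.Product using (_×_; _,_; proj₁; proj₂; ∃-syntax)
open import Data.Sum using (_⊎_; inj₁; inj₂)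
open import Function using (_∘_; id)
open import Level using (Level; 0ℓ)
open import Relation.Nullary using (¬_; yes; no; ¬?; _×-dec_; _⊎-dec_)
open import Relation.Nullary.Negation using (contradiction)
open import Relation.Unary using (Pred; Decidable)
open import Relation.Binary.PropositionalEquality

private variable
  a b ℓ ℓ′ : Level
  A : Set a
  B : Set b
  P Q : Pred ℕ ℓ

-- Counting on initial segments of ℕ

count : Decidable P → ℕ → ℕ
count P? zero = 0
count P? (suc n) with P? 0
... | yes _ = suc (count (P? ∘ suc) n)
... | no  _ = count (P? ∘ suc) n

length-filter-applyUpTo : (P? : Decidable P) (f : ℕ → ℕ) (n : ℕ) →
                          length (filter P? (applyUpTo f n)) ≡ count (P? ∘ f) n
length-filter-applyUpTo P? f zero = refl
length-filter-applyUpTo P? f (suc n) with P? (f 0)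
... | yes _ = cong suc (length-filter-applyUpTo P? (f ∘ suc) n)
... | no  _ = length-filter-applyUpTo P? (f ∘ suc) n

count-accept-head : (P? : Decidable P) {n : ℕ} → P 0 → count P? (suc n) ≡ suc (count (P? ∘ suc) n)
count-accept-head P? p with P? 0
... | yes _ = refl
... | no ¬p = contradiction p ¬p

count-reject-head : (P? : Decidable P) {n : ℕ} → ¬ P 0 → count P? (suc n) ≡ count (P? ∘ suc) n
count-reject-head P? ¬p with P? 0
... | yes p = contradiction p ¬p
... | no  _ = refl

count-≤ : (P? : Decidable P) (n : ℕ) → count P? n ≤ n
count-≤ P? zero = z≤n
count-≤ P? (suc n) with P? 0
... | yes _ = s≤s (count-≤ (P? ∘ suc) n)
... | no  _ = m≤n⇒m≤1+n (count-≤ (P? ∘ suc) n)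

count-mono : (P? : Decidable P) (Q? : Decidable Q) (n : ℕ) →
             (∀ i → i < n → P i → Q i) → count P? n ≤ count Q? n
count-mono P? Q? zero    P⇒Q = z≤n
count-mono P? Q? (suc n) P⇒Q with P? 0 | Q? 0 | count-mono (P? ∘ suc) (Q? ∘ suc) n (λ i → P⇒Q (suc i) ∘ s≤s)
... | yes _ | yes _ | tail≤ = s≤s tail≤
... | yes p | no ¬q | _     = contradiction (P⇒Q 0 z<s p) ¬q
... | no  _ | yes _ | tail≤ = m≤n⇒m≤1+n tail≤
... | no  _ | no  _ | tail≤ = tail≤

count-+ : (P? : Decidable P) (m n : ℕ) → count P? (m + n) ≡ count P? m + count (P? ∘ (m +_)) n
count-+ P? zero    n = refl
count-+ P? (suc m) n with P? 0
... | yes _ = cong suc (count-+ (P? ∘ suc) m n)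
... | no  _ = count-+ (P? ∘ suc) m n

count-monoʳ : (P? : Decidable P) {m n : ℕ} → m ≤ n → count P? m ≤ count P? n
count-monoʳ P? {m} {n} m≤n = begin
  count P? m                                 ≤⟨ m≤m+n _ _ ⟩
  count P? m + count (P? ∘ (m +_)) (n ∸ m)   ≡⟨ count-+ P? m (n ∸ m) ⟨
  count P? (m + (n ∸ m))                     ≡⟨ cong (count P?) (m+[n∸m]≡n m≤n) ⟩
  count P? n                                 ∎
  where open ≤-Reasoning

count-complement : (P? : Decidable P) (n : ℕ) → count P? n + count (¬? ∘ P?) n ≡ n
count-complement P? zero = refl
count-complement P? (suc n) with P? 0
... | yes _ = cong suc (count-complement (P? ∘ suc) n)
... | no  _ = trans (+-suc _ _) (cong suc (count-complement (P? ∘ suc) n))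

count-all : (P? : Decidable P) (n : ℕ) → (∀ i → i < n → P i) → count P? n ≡ n
count-all P? zero    all = refl
count-all P? (suc n) all = trans (count-accept-head P? (all 0 z<s))
                                 (cong suc (count-all (P? ∘ suc) n (λ i → all (suc i) ∘ s≤s)))

count-none : (P? : Decidable P) (n : ℕ) → (∀ i → i < n → ¬ P i) → count P? n ≡ 0
count-none P? zero    none = refl
count-none P? (suc n) none = trans (count-reject-head P? (none 0 z<s))
                                   (count-none (P? ∘ suc) n (λ i → none (suc i) ∘ s≤s))

count-periodic : (P? : Decidable P) (B C : ℕ) → (∀ k → count (P? ∘ (k * B +_)) B ≤ C) →
                 ∀ q → count P? (q * B) ≤ q * C
count-periodic         P? B C block zero    = z≤n
count-periodic {P = P} P? B C block (suc q) = begin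
  count P? (B + q * B)                       ≡⟨ count-+ P? B (q * B) ⟩
  count P? B + count (P? ∘ (B +_)) (q * B)   ≤⟨ +-mono-≤ (block 0) (count-periodic (P? ∘ (B +_)) B C block′ q) ⟩
  C + q * C                                  ∎
  where
  open ≤-Reasoning
  block′ : ∀ k → count (P? ∘ (B +_) ∘ (k * B +_)) B ≤ C
  block′ k = ≤-trans (count-mono _ (P? ∘ (suc k * B +_)) B (λ i _ → subst P (sym (+-assoc B (k * B) i))))
                     (block (suc k))

count-periodic-density : (P? : Decidable P) (B C : ℕ) .{{_ : NonZero B}} →
                         (∀ k → count (P? ∘ (k * B +_)) B ≤ C) →
                         ∀ N → B * count P? N ≤ C * (N + B)
count-periodic-density P? B C block N = begin
  B * count P? N          ≤⟨ *-monoʳ-≤ B (count-monoʳ P? N≤qB) ⟩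
  B * count P? (q * B)    ≤⟨ *-monoʳ-≤ B (count-periodic P? B C block q) ⟩
  B * (q * C)             ≡⟨ *-CS.x∙yz≈z∙yx B q C ⟩
  C * (q * B)             ≤⟨ *-monoʳ-≤ C qB≤N+B ⟩
  C * (N + B)             ∎
  where
  open ≤-Reasoning
  q : ℕ
  q = suc (N / B)
  N≤qB : N ≤ q * B
  N≤qB = begin
    N                  ≡⟨ m≡m%n+[m/n]*n N B ⟩
    N % B + N / B * B  ≤⟨ +-monoˡ-≤ (N / B * B) (<⇒≤ (m%n<n N B)) ⟩
    B + N / B * B      ∎
  qB≤N+B : q * B ≤ N + B
  qB≤N+B = subst (_≤ N + B) (+-comm (N / B * B) B) (+-monoˡ-≤ B (m/n*n≤m N B))

length-filter-++ : {R : Pred A ℓ} (R? : Decidable R) (xs ys : List A) →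
                   length (filter R? (xs ++ ys)) ≡ length (filter R? xs) + length (filter R? ys)
length-filter-++ R? xs ys = trans (cong length (filter-++ R? xs ys)) (length-++ (filter R? xs))

length-filter-≤-pairs : {P : Pred A ℓ} {R : Pred (A × B) ℓ′} (P? : Decidable P) (R? : Decidable R)
                        (xs : List A) (ys : List B) →
                        (∀ {x} → x ∈ xs → P x → Any (λ y → R (x , y)) ys) →
                        length (filter P? xs) ≤ length (filter R? (concatMap (λ x → map (x ,_) ys) xs))
length-filter-≤-pairs P? R? []       ys pair = z≤n
length-filter-≤-pairs P? R? (x ∷ xs) ys pair with P? x
... | yes px = ≤-trans (+-mono-≤ (filter-some R? (Any.map⁺ (pair (here refl) px)))
                                 (length-filter-≤-pairs P? R? xs ys (pair ∘ there)))
                       (≤-reflexive (sym (length-filter-++ R? (map (x ,_) ys) _)))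
... | no _   = ≤-trans (length-filter-≤-pairs P? R? xs ys (pair ∘ there))
                       (≤-trans (m≤n+m _ _) (≤-reflexive (sym (length-filter-++ R? (map (x ,_) ys) _))))

-- Binary weight

[1+n]/2≤n : ∀ n → suc n / 2 ≤ n
[1+n]/2≤n n = ≤-pred (m/n<m (suc n) 2 (s≤s (s≤s z≤n)))

wAux-fuel : ∀ f g n → n ≤ f → n ≤ g → wAux f n ≡ wAux g n
wAux-fuel zero    zero    n       _         _         = refl
wAux-fuel f       g       zero    _         _         = trans (wAux-zero f) (sym (wAux-zero g))
  where
  wAux-zero : ∀ f → wAux f 0 ≡ 0
  wAux-zero zero    = refl
  wAux-zero (suc f) = wAux-zero f
wAux-fuel (suc f) (suc g) (suc n) (s≤s n≤f) (s≤s n≤g) =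
  cong (suc n % 2 +_) (wAux-fuel f g (suc n / 2) (≤-trans ([1+n]/2≤n n) n≤f) (≤-trans ([1+n]/2≤n n) n≤g))

w-step : ∀ n → w n ≡ n % 2 + w (n / 2)
w-step zero    = refl
w-step (suc n) = cong (suc n % 2 +_) (wAux-fuel n (suc n / 2) (suc n / 2) ([1+n]/2≤n n) ≤-refl)

w-bit : ∀ b q → b < 2 → w (b + q * 2) ≡ b + w q
w-bit b q b<2 = begin
  w (b + q * 2)                            ≡⟨ w-step (b + q * 2) ⟩
  (b + q * 2) % 2 + w ((b + q * 2) / 2)    ≡⟨ cong₂ (λ x y → x + w y) low high ⟩
  b + w q                                  ∎
  where
  open ≡-Reasoning
  low : (b + q * 2) % 2 ≡ b
  low = trans ([m+kn]%n≡m%n b q 2) (m<n⇒m%n≡m b<2)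
  high : (b + q * 2) / 2 ≡ q
  high = begin
    (b + q * 2) / 2    ≡⟨ +-distrib-/-∣ʳ b (divides-refl q) ⟩
    b / 2 + q * 2 / 2  ≡⟨ cong₂ _+_ (m<n⇒m/n≡0 b<2) (m*n/n≡m q 2) ⟩
    q                  ∎

w-concat : ∀ K q r → r < 2 ^ K → w (q * 2 ^ K + r) ≡ w q + w r
w-concat zero    q zero    _         = trans (cong w (trans (+-identityʳ _) (*-identityʳ q))) (sym (+-identityʳ (w q)))
w-concat zero    q (suc r) (s≤s ())
w-concat (suc K) q r       r<2^1+K   = begin
  w (q * 2 ^ suc K + r)                   ≡⟨ cong (λ x → w (q * 2 ^ suc K + x)) (m≡m%n+[m/n]*n r 2) ⟩
  w (q * 2 ^ suc K + (r % 2 + r / 2 * 2)) ≡⟨ cong w (regroup q (2 ^ K) (r % 2) (r / 2)) ⟩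
  w (r % 2 + (q * 2 ^ K + r / 2) * 2)     ≡⟨ w-bit (r % 2) (q * 2 ^ K + r / 2) (m%n<n r 2) ⟩
  r % 2 + w (q * 2 ^ K + r / 2)           ≡⟨ cong (r % 2 +_) (w-concat K q (r / 2) r/2<2^K) ⟩
  r % 2 + (w q + w (r / 2))               ≡⟨ +-CS.x∙yz≈y∙xz (r % 2) (w q) _ ⟩
  w q + (r % 2 + w (r / 2))               ≡⟨ cong (w q +_) (w-step r) ⟨
  w q + w r                               ∎
  where
  open ≡-Reasoning
  r/2<2^K : r / 2 < 2 ^ K
  r/2<2^K = m<n*o⇒m/o<n (subst (r <_) (*-comm 2 (2 ^ K)) r<2^1+K)
  regroup : ∀ q p a b → q * (2 * p) + (a + b * 2) ≡ a + (q * p + b) * 2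
  regroup = solve-∀

odd-sum-of-halves : ∀ a b x y n → a < 2 → b < 2 → suc ((a + x * 2) + (b + y * 2)) ≡ 2 * n →
                    a + b ≡ 1 × suc (x + y) ≡ n
odd-sum-of-halves 0 0 x y n _ _ e = contradiction (trans (sym e) (lhs≡ x y)) (even≢odd n (x + y))
  where
  lhs≡ : ∀ x y → suc ((0 + x * 2) + (0 + y * 2)) ≡ suc (2 * (x + y))
  lhs≡ = solve-∀
odd-sum-of-halves 1 1 x y n _ _ e = contradiction (trans (sym e) (lhs≡ x y)) (even≢odd n (suc (x + y)))
  where
  lhs≡ : ∀ x y → suc ((1 + x * 2) + (1 + y * 2)) ≡ suc (2 * suc (x + y))
  lhs≡ = solve-∀
odd-sum-of-halves 1 0 x y n _ _ e = refl , *-cancelˡ-≡ (suc (x + y)) n 2 (trans (lhs≡ x y) e)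
  where
  lhs≡ : ∀ x y → 2 * suc (x + y) ≡ suc ((1 + x * 2) + (0 + y * 2))
  lhs≡ = solve-∀
odd-sum-of-halves 0 1 x y n _ _ e = refl , *-cancelˡ-≡ (suc (x + y)) n 2 (trans (lhs≡ x y) e)
  where
  lhs≡ : ∀ x y → 2 * suc (x + y) ≡ suc ((0 + x * 2) + (1 + y * 2))
  lhs≡ = solve-∀
odd-sum-of-halves (2+ _) _      _ _ _ (s≤s (s≤s ())) _
odd-sum-of-halves _      (2+ _) _ _ _ _              (s≤s (s≤s ()))

w-complement : ∀ K r s → suc (r + s) ≡ 2 ^ K → w r + w s ≡ K
w-complement zero    zero    zero    _  = refl
w-complement zero    (suc r) s       ()
w-complement zero    zero    (suc s) ()
w-complement (suc K) r       s       e  = begin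
  w r + w s                                   ≡⟨ cong₂ _+_ (w-step r) (w-step s) ⟩
  (r % 2 + w (r / 2)) + (s % 2 + w (s / 2))   ≡⟨ +-CS.interchange (r % 2) _ _ _ ⟩
  (r % 2 + s % 2) + (w (r / 2) + w (s / 2))   ≡⟨ cong₂ _+_ (proj₁ halves) (w-complement K (r / 2) (s / 2) (proj₂ halves)) ⟩
  suc K                                       ∎
  where
  open ≡-Reasoning
  halves : r % 2 + s % 2 ≡ 1 × suc (r / 2 + s / 2) ≡ 2 ^ K
  halves = odd-sum-of-halves (r % 2) (s % 2) (r / 2) (s / 2) (2 ^ K) (m%n<n r 2) (m%n<n s 2)
             (trans (cong₂ (λ x y → suc (x + y)) (sym (m≡m%n+[m/n]*n r 2)) (sym (m≡m%n+[m/n]*n s 2))) e)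

w-≤ : ∀ n → w n ≤ n
w-≤ n = wAux-≤ n n
  where
  wAux-≤ : ∀ f n → wAux f n ≤ n
  wAux-≤ zero    n = z≤n
  wAux-≤ (suc f) n = begin
    n % 2 + wAux f (n / 2)   ≤⟨ +-monoʳ-≤ (n % 2) (≤-trans (wAux-≤ f (n / 2)) (m≤m*n (n / 2) 2)) ⟩
    n % 2 + n / 2 * 2        ≡⟨ m≡m%n+[m/n]*n n 2 ⟨
    n                        ∎
    where open ≤-Reasoning

w-≤-bits : ∀ K r → r < 2 ^ K → w r ≤ K
w-≤-bits K r r<2^K = subst (w r ≤_) (w-complement K r (2 ^ K ∸ suc r) (m+[n∸m]≡n r<2^K)) (m≤m+n (w r) _)

w-all-ones : ∀ K {n} → suc n ≡ 2 ^ K → w n ≡ K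
w-all-ones K {n} e = trans (sym (+-identityʳ (w n))) (w-complement K n 0 (trans (cong suc (+-identityʳ n)) e))

w-sum-<-complement : ∀ K a x y → suc (x + y) ≡ 2 ^ K → w a < w x → w a + w y < K
w-sum-<-complement K a x y e wa<wx = subst (w a + w y <_) (w-complement K x y e) (+-monoˡ-< (w y) wa<wx)

-- Ascents and descents of n ↦ w (n + t) − w n

Ascent Descent : ℕ → Pred ℕ 0ℓ
Ascent  t n = w n < w (n + t)
Descent t n = w (n + t) < w n

ascent? : ∀ t → Decidable (Ascent t)
ascent? t n = w n <? w (n + t)

descent? : ∀ t → Decidable (Descent t)
descent? t n = w (n + t) <? w n

¬Descent-0 : ∀ t → ¬ Descent t 0
¬Descent-0 t ()

w-in-block : ∀ K k {r t} → r + t < 2 ^ K →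
             w (k * 2 ^ K + r) ≡ w k + w r × w (k * 2 ^ K + r + t) ≡ w k + w (r + t)
w-in-block K k {r} {t} r+t<2^K =
  w-concat K k r (≤-<-trans (m≤m+n r t) r+t<2^K) ,
  trans (cong w (+-assoc (k * 2 ^ K) r t)) (w-concat K k (r + t) r+t<2^K)

ascent-in-block : ∀ K k {r t} → r + t < 2 ^ K → Ascent t (k * 2 ^ K + r) → Ascent t r
ascent-in-block K k r+t<2^K asc with e₁ , e₂ ← w-in-block K k r+t<2^K =
  +-cancelˡ-< (w k) _ _ (subst₂ _<_ e₁ e₂ asc)

descent-in-block : ∀ K k {r t} → r + t < 2 ^ K → Descent t (k * 2 ^ K + r) → Descent t r
descent-in-block K k r+t<2^K desc with e₁ , e₂ ← w-in-block K k r+t<2^K =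
  +-cancelˡ-< (w k) _ _ (subst₂ _<_ e₂ e₁ desc)

-- Adding t lands on k·2^K + (2^K − 1), whose low K bits are all ones.
¬Descent-before-all-ones : ∀ K k {L t} → suc (L + t) ≡ 2 ^ K → ¬ Descent t (k * 2 ^ K + L)
¬Descent-before-all-ones K k {L} {t} split desc = <⇒≱ (subst₂ _<_ e₂ e₁ desc) (+-monoʳ-≤ (w k) wL≤K)
  where
  L+t<2^K : L + t < 2 ^ K
  L+t<2^K = subst (L + t <_) split (n<1+n (L + t))
  e₁ : w (k * 2 ^ K + L) ≡ w k + w L
  e₁ = proj₁ (w-in-block K k L+t<2^K)
  e₂ : w (k * 2 ^ K + L + t) ≡ w k + K
  e₂ = trans (proj₂ (w-in-block K k L+t<2^K)) (cong (w k +_) (w-all-ones K split))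
  wL≤K : w L ≤ K
  wL≤K = w-≤-bits K L (≤-<-trans (m≤m+n L t) L+t<2^K)

module _ (K : ℕ) {t L : ℕ} (split : suc (L + t) ≡ 2 ^ K) (k : ℕ) where

  private
    offset<2^K : ∀ {r} → r < L → r + t < 2 ^ K
    offset<2^K r<L = subst (_ <_) split (s≤s (+-monoˡ-≤ t (<⇒≤ r<L)))

    2^K≡L+[1+t] : 2 ^ K ≡ L + suc t
    2^K≡L+[1+t] = trans (sym split) (sym (+-suc L t))

  ascents-per-block : count (ascent? t ∘ (k * 2 ^ K +_)) (2 ^ K) ≤ count (ascent? t) L + suc t
  ascents-per-block = begin
    count asc? (2 ^ K)                              ≡⟨ cong (count asc?) 2^K≡L+[1+t] ⟩
    count asc? (L + suc t)                          ≡⟨ count-+ asc? L (suc t) ⟩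
    count asc? L + count (asc? ∘ (L +_)) (suc t)    ≤⟨ +-mono-≤ in-block (count-≤ (asc? ∘ (L +_)) (suc t)) ⟩
    count (ascent? t) L + suc t                     ∎
    where
    open ≤-Reasoning
    asc? : Decidable (Ascent t ∘ (k * 2 ^ K +_))
    asc? = ascent? t ∘ (k * 2 ^ K +_)
    in-block : count asc? L ≤ count (ascent? t) L
    in-block = count-mono asc? (ascent? t) L (λ _ → ascent-in-block K k ∘ offset<2^K)

  descents-per-block : count (descent? t ∘ (k * 2 ^ K +_)) (2 ^ K) ≤ count (descent? t) L + t
  descents-per-block = begin
    count desc? (2 ^ K)                             ≡⟨ cong (count desc?) 2^K≡L+[1+t] ⟩
    count desc? (L + suc t)                         ≡⟨ count-+ desc? L (suc t) ⟩
    count desc? L + count (desc? ∘ (L +_)) (suc t)  ≡⟨ cong (count desc? L +_) (count-reject-head (desc? ∘ (L +_)) ¬desc-at-L) ⟩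
    count desc? L + count (desc? ∘ (L +_) ∘ suc) t  ≤⟨ +-mono-≤ in-block (count-≤ (desc? ∘ (L +_) ∘ suc) t) ⟩
    count (descent? t) L + t                        ∎
    where
    open ≤-Reasoning
    desc? : Decidable (Descent t ∘ (k * 2 ^ K +_))
    desc? = descent? t ∘ (k * 2 ^ K +_)
    in-block : count desc? L ≤ count (descent? t) L
    in-block = count-mono desc? (descent? t) L (λ _ → descent-in-block K k ∘ offset<2^K)
    ¬desc-at-L : ¬ Descent t (k * 2 ^ K + (L + 0))
    ¬desc-at-L = subst (λ r → ¬ Descent t (k * 2 ^ K + r)) (sym (+-identityʳ L)) (¬Descent-before-all-ones K k split)

-- Lower bounds for |S_{t,k}|

modulus : ℕ → ℕ
modulus j = 2 ^ suc j ∸ 1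

n<2^n : ∀ n → n < 2 ^ n
n<2^n zero    = z<s
n<2^n (suc n) = ≤-trans (s≤s (n<2^n n)) (+-mono-≤ (m^n>0 2 n) (m≤m+n (2 ^ n) 0))

suc-modulus : ∀ j → suc (modulus j) ≡ 2 ^ suc j
suc-modulus j = m+[n∸m]≡n (m^n>0 2 (suc j))

j<modulus : ∀ j → j < modulus j
j<modulus j = m+n≤o⇒m≤o∸n (suc j) (subst (_≤ 2 ^ suc j) (+-comm 1 (suc j)) (n<2^n (suc j)))

modulus-split : ∀ j {t} → t ≤ modulus j → suc ((modulus j ∸ t) + t) ≡ 2 ^ suc j
modulus-split j t≤M = trans (cong suc (m∸n+n≡m t≤M)) (suc-modulus j)

module _ (j : ℕ) where

  private instance
    modulus-nonZero : NonZero (modulus j)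
    modulus-nonZero = pow-1-nonZero j

  InS : ℕ → ℕ → ℕ → Set
  InS t a b = (a + b) % modulus j ≡ t % modulus j × w a + w b < suc j

  count≤SCard : ∀ t (P? : Decidable P) →
                (∀ a → a < modulus j → P a → ∃[ b ] (b < modulus j × InS t a b)) →
                count P? (modulus j) ≤ SCard j t
  count≤SCard {P = P} t P? pair = subst (_≤ SCard j t) (length-filter-applyUpTo P? id (modulus j))
    (length-filter-≤-pairs P? _ (upTo (modulus j)) (upTo (modulus j)) pair′)
    where
    pair′ : ∀ {a} → a ∈ upTo (modulus j) → P a → Any (InS t a) (upTo (modulus j))
    pair′ {a} a∈ pa = let b , b<M , s = pair a (∈-upTo⁻ a∈) pa in lose (∈-upTo⁺ b<M) s

  modulus≡ : ∀ t L → suc (L + t) ≡ 2 ^ suc j → modulus j ≡ L + t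
  modulus≡ t L split = cong (_∸ 1) (sym split)

  ascents-≤-SCard : ∀ {t L} → 1 ≤ t → suc (L + t) ≡ 2 ^ suc j → count (ascent? t) L ≤ SCard j L
  ascents-≤-SCard {t} {L} 1≤t split = begin
    count (ascent? t) L       ≤⟨ count-mono (ascent? t) below? L (λ _ a<L asc → a<L , asc) ⟩
    count below? L            ≤⟨ count-monoʳ below? (<⇒≤ L<M) ⟩
    count below? (modulus j)  ≤⟨ count≤SCard L below? pair ⟩
    SCard j L                 ∎
    where
    open ≤-Reasoning
    L<M : L < modulus j
    L<M = subst (L <_) (sym (modulus≡ t L split)) (m<m+n L 1≤t)
    below? : Decidable (λ a → a < L × Ascent t a)
    below? a = a <? L ×-dec ascent? t a
    pair : ∀ a → a < modulus j → a < L × Ascent t a → ∃[ b ] (b < modulus j × InS L a b)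
    pair a _ (a<L , asc) = L ∸ a , ≤-<-trans (m∸n≤m L a) L<M , cong (_% modulus j) a+[L∸a]≡L ,
                           w-sum-<-complement (suc j) a (a + t) (L ∸ a) (trans (cong suc [a+t]+[L∸a]≡L+t) split) asc
      where
      a+[L∸a]≡L : a + (L ∸ a) ≡ L
      a+[L∸a]≡L = m+[n∸m]≡n (<⇒≤ a<L)
      [a+t]+[L∸a]≡L+t : (a + t) + (L ∸ a) ≡ L + t
      [a+t]+[L∸a]≡L+t = trans (+-CS.xy∙z≈xz∙y a t (L ∸ a)) (cong (_+ t) a+[L∸a]≡L)

  -- M − n is the bitwise complement of n, so w (n + t) < w n gives w (n + t) + w (M − n) < k.
  descent-pair : ∀ {t} → t ≤ j → ∀ a → a < modulus j → a ≤ t ⊎ Descent t (a ∸ t) → ∃[ b ] (b < modulus j × InS t a b)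
  descent-pair {t} t≤j a a<M (inj₁ a≤t) =
    t ∸ a , ≤-<-trans (m∸n≤m t a) (≤-<-trans t≤j (j<modulus j)) , cong (_% modulus j) a+[t∸a]≡t ,
    s≤s (≤-trans (+-mono-≤ (w-≤ a) (w-≤ (t ∸ a))) (≤-trans (≤-reflexive a+[t∸a]≡t) t≤j))
    where
    a+[t∸a]≡t : a + (t ∸ a) ≡ t
    a+[t∸a]≡t = m+[n∸m]≡n a≤t
  descent-pair {t} t≤j a a<M (inj₂ desc) =
    M ∸ n , ∸-monoʳ-< (m<n⇒0<n∸m t<a) n≤M , trans (cong (_% M) a+[M∸n]≡t+M) ([m+n]%n≡m%n t M) ,
    w-sum-<-complement (suc j) a n (M ∸ n) (trans (cong suc n+[M∸n]≡M) (suc-modulus j)) (subst (λ x → w x < w n) n+t≡a desc)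
    where
    M n : ℕ
    M = modulus j
    n = a ∸ t
    t<a : t < a
    t<a = ≰⇒> (λ a≤t → ¬Descent-0 t (subst (Descent t) (m≤n⇒m∸n≡0 a≤t) desc))
    n+t≡a : n + t ≡ a
    n+t≡a = m∸n+n≡m (<⇒≤ t<a)
    n≤M : n ≤ M
    n≤M = ≤-trans (m∸n≤m a t) (<⇒≤ a<M)
    n+[M∸n]≡M : n + (M ∸ n) ≡ M
    n+[M∸n]≡M = m+[n∸m]≡n n≤M
    a+[M∸n]≡t+M : a + (M ∸ n) ≡ t + M
    a+[M∸n]≡t+M = begin
      a + (M ∸ n)        ≡⟨ cong (_+ (M ∸ n)) n+t≡a ⟨
      n + t + (M ∸ n)    ≡⟨ +-CS.xy∙z≈y∙xz n t (M ∸ n) ⟩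
      t + (n + (M ∸ n))  ≡⟨ cong (t +_) n+[M∸n]≡M ⟩
      t + M              ∎
      where open ≡-Reasoning

  descents-≤-SCard : ∀ {t L} → t ≤ j → suc (L + t) ≡ 2 ^ suc j → count (descent? t) L + suc t ≤ SCard j t
  descents-≤-SCard {t} {zero}  t≤j split = contradiction (subst (j <_) (modulus≡ t 0 split) (j<modulus j)) (≤⇒≯ t≤j)
  descents-≤-SCard {t} {suc L} t≤j split = begin
    count (descent? t) (suc L) + suc t                    ≡⟨ cong (_+ suc t) (count-reject-head (descent? t) {L} (¬Descent-0 t)) ⟩
    count (descent? t ∘ suc) L + suc t                    ≤⟨ +-monoˡ-≤ (suc t) (count-mono (descent? t ∘ suc) (covered? ∘ (t +_) ∘ suc) L shifted) ⟩
    count (covered? ∘ (t +_) ∘ suc) L + suc t             ≡⟨ trans (+-comm _ (suc t)) (sym (+-suc t _)) ⟩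
    t + suc (count (covered? ∘ (t +_) ∘ suc) L)           ≡⟨ cong₂ _+_ (count-all covered? t (λ _ i<t → inj₁ (<⇒≤ i<t)))
                                                                       (count-accept-head (covered? ∘ (t +_)) {L} (inj₁ (≤-reflexive (+-identityʳ t)))) ⟨
    count covered? t + count (covered? ∘ (t +_)) (suc L)  ≡⟨ count-+ covered? t (suc L) ⟨
    count covered? (t + suc L)                            ≡⟨ cong (count covered?) (trans (+-comm t (suc L)) (sym (modulus≡ t (suc L) split))) ⟩
    count covered? (modulus j)                            ≤⟨ count≤SCard t covered? (descent-pair t≤j) ⟩
    SCard j t                                             ∎
    where
    open ≤-Reasoning
    covered? : Decidable (λ a → a ≤ t ⊎ Descent t (a ∸ t))
    covered? a = a ≤? t ⊎-dec descent? t (a ∸ t)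
    shifted : ∀ i → i < L → Descent t (suc i) → t + suc i ≤ t ⊎ Descent t (t + suc i ∸ t)
    shifted i _ desc = inj₂ (subst (Descent t) (sym (m+n∸m≡n t (suc i))) desc)

ge-arithmetic : ∀ h N g d → N ≤ g + d → 2 * suc h * d ≤ h * (N + 2 * suc h) → 4 * suc h * h ≤ N →
                (2 * suc h + 1) * N ≤ 2 * (2 * suc h) * g
ge-arithmetic h N g d N≤g+d block N₀≤N = +-cancelʳ-≤ (4 * suc h * h) _ _ (begin
  (2 * suc h + 1) * N + 4 * suc h * h   ≤⟨ +-monoʳ-≤ ((2 * suc h + 1) * N) N₀≤N ⟩
  (2 * suc h + 1) * N + N               ≡⟨ solve (h ∷ N ∷ []) ⟩
  (2 * suc h + 2) * N                   ≤⟨ +-cancelʳ-≤ (2 * h * N) _ _ key ⟩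
  2 * (2 * suc h) * g + 4 * suc h * h   ∎)
  where
  open ≤-Reasoning
  key : (2 * suc h + 2) * N + 2 * h * N ≤ 2 * (2 * suc h) * g + 4 * suc h * h + 2 * h * N
  key = begin
    (2 * suc h + 2) * N + 2 * h * N                ≡⟨ solve (h ∷ N ∷ []) ⟩
    2 * (2 * suc h) * N                            ≤⟨ *-monoʳ-≤ (2 * (2 * suc h)) N≤g+d ⟩
    2 * (2 * suc h) * (g + d)                      ≡⟨ solve (h ∷ g ∷ d ∷ []) ⟩
    2 * (2 * suc h) * g + 2 * (2 * suc h * d)      ≤⟨ +-monoʳ-≤ (2 * (2 * suc h) * g) (*-monoʳ-≤ 2 block) ⟩
    2 * (2 * suc h) * g + 2 * (h * (N + 2 * suc h)) ≡⟨ solve (h ∷ N ∷ g ∷ []) ⟩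
    2 * (2 * suc h) * g + 4 * suc h * h + 2 * h * N ∎

gt-arithmetic : ∀ m s H N c .{{_ : NonZero H}} → 2 * m * s ≤ H → 2 * H * c ≤ (H + s) * (N + 2 * H) →
                (2 * m + 1) * (2 * H) ≤ N → 2 * m * c ≤ (m + 1) * N
gt-arithmetic m s H N c 2ms≤H density N₀≤N = *-cancelˡ-≤ 2 (*-cancelˡ-≤ (2 * H) {{m*n≢0 2 H}} (begin
  2 * H * (2 * (2 * m * c))                   ≡⟨ solve (m ∷ H ∷ c ∷ []) ⟩
  2 * (2 * m) * (2 * H * c)                   ≤⟨ *-monoʳ-≤ (2 * (2 * m)) density ⟩
  2 * (2 * m) * ((H + s) * (N + 2 * H))   ≡⟨ solve (m ∷ s ∷ H ∷ N ∷ []) ⟩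
  (2 * m * (2 * H) + 2 * (2 * m * s)) * (N + 2 * H)
                                                  ≤⟨ *-monoˡ-≤ (N + 2 * H) (+-monoʳ-≤ (2 * m * (2 * H)) (*-monoʳ-≤ 2 2ms≤H)) ⟩
  (2 * m * (2 * H) + 2 * H) * (N + 2 * H)
                                                  ≡⟨ solve (m ∷ H ∷ N ∷ []) ⟩
  2 * H * ((2 * m + 1) * N + (2 * m + 1) * (2 * H))
                                                  ≤⟨ *-monoʳ-≤ (2 * H) (+-monoʳ-≤ ((2 * m + 1) * N) N₀≤N) ⟩
  2 * H * ((2 * m + 1) * N + N)               ≡⟨ solve (m ∷ H ∷ N ∷ []) ⟩
  2 * H * (2 * ((m + 1) * N))                 ∎))
  where open ≤-Reasoning

SCardBound : Set
SCardBound = ∀ (j t : ℕ) → 1 ≤ t → t ≤ 2 ^ suc j ∸ 2 → SCard j t ≤ 2 ^ j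

-- Encodings of "lim inf f(N)/N > 1/2" and "lim sup f(N)/N ≤ 1/2".
DensityAboveHalf DensityAtMostHalf : (ℕ → ℕ) → Set
DensityAboveHalf  f = ∃[ a ] ∃[ b ] (0 < b × b < 2 * a × ∃[ N₀ ] (∀ N → N₀ ≤ N → a * N ≤ b * f N))
DensityAtMostHalf f = ∀ (m : ℕ) → 1 ≤ m → ∃[ N₀ ] (∀ N → N₀ ≤ N → (2 * m) * f N ≤ (m + 1) * N)

<modulus⇒≤2^[1+j]∸2 : ∀ j {a} → a < modulus j → a ≤ 2 ^ suc j ∸ 2
<modulus⇒≤2^[1+j]∸2 j {a} a<M =
  subst (a ≤_) (∸-+-assoc (2 ^ suc j) 1 1) (m+n≤o⇒m≤o∸n a (subst (_≤ modulus j) (+-comm 1 a) a<M))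

weakly-ascent? : ∀ t → Decidable (λ n → w n ≤ w (n + t))
weakly-ascent? t n = w n ≤? w (n + t)

descents-per-block-< : SCardBound → ∀ t → 1 ≤ t → ∀ k →
                       count (descent? t ∘ (k * 2 ^ suc t +_)) (2 ^ suc t) < 2 ^ t
descents-per-block-< bound t 1≤t k = begin-strict
  count (descent? t ∘ (k * 2 ^ suc t +_)) (2 ^ suc t)  ≤⟨ descents-per-block (suc t) split k ⟩
  count (descent? t) (modulus t ∸ t) + t               <⟨ +-monoʳ-< _ (n<1+n t) ⟩
  count (descent? t) (modulus t ∸ t) + suc t           ≤⟨ descents-≤-SCard t ≤-refl split ⟩
  SCard t t                                            ≤⟨ bound t t 1≤t (<modulus⇒≤2^[1+j]∸2 t (j<modulus t)) ⟩
  2 ^ t                                                ∎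
  where
  open ≤-Reasoning
  split : suc ((modulus t ∸ t) + t) ≡ 2 ^ suc t
  split = modulus-split t (<⇒≤ (j<modulus t))

-- countGE t N / N ≥ (2^t + 1)/2^(t+1) − o(1), which exceeds a/b = (2·2^t + 1)/(4·2^t).
countGE-density-pos : SCardBound → ∀ t → 1 ≤ t → DensityAboveHalf (countGE t)
countGE-density-pos bound t 1≤t =
  2 * suc h + 1 , 2 * (2 * suc h) , z<s , *-monoʳ-< 2 (m<m+n (2 * suc h) z<s) , 4 * suc h * h ,
  λ N → ge-arithmetic h N (countGE t N) (count (descent? t) N) (N≤GE+D N) (density N)
  where
  h : ℕ
  h = pred (2 ^ t)
  2^t≡1+h : 2 ^ t ≡ suc h
  2^t≡1+h = sym (suc-pred (2 ^ t) {{m^n≢0 2 t}})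
  density : ∀ N → 2 * suc h * count (descent? t) N ≤ h * (N + 2 * suc h)
  density N = subst (λ H → 2 * H * count (descent? t) N ≤ h * (N + 2 * H)) 2^t≡1+h
                    (count-periodic-density (descent? t) (2 ^ suc t) h {{m^n≢0 2 (suc t)}}
                                            (<⇒≤pred ∘ descents-per-block-< bound t 1≤t) N)
  N≤GE+D : ∀ N → N ≤ countGE t N + count (descent? t) N
  N≤GE+D N = begin
    N                                                              ≡⟨ count-complement (weakly-ascent? t) N ⟨
    count (weakly-ascent? t) N + count (¬? ∘ weakly-ascent? t) N  ≤⟨ +-monoʳ-≤ _ (count-mono _ (descent? t) N (λ _ _ → ≰⇒>)) ⟩
    count (weakly-ascent? t) N + count (descent? t) N              ≡⟨ cong (_+ count (descent? t) N) (length-filter-applyUpTo (weakly-ascent? t) id N) ⟨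
    countGE t N + count (descent? t) N                             ∎
    where open ≤-Reasoning

countGE-density : SCardBound → ∀ t → DensityAboveHalf (countGE t)
countGE-density bound zero = 1 , 1 , z<s , s≤s z<s , 0 , λ N _ → *-monoʳ-≤ 1 (≤-reflexive (sym (countGE-0 N)))
  where
  countGE-0 : ∀ N → countGE 0 N ≡ N
  countGE-0 N = trans (length-filter-applyUpTo (weakly-ascent? 0) id N)
                      (count-all (weakly-ascent? 0) N (λ i _ → ≤-reflexive (cong w (sym (+-identityʳ i)))))
countGE-density bound t@(suc _) = countGE-density-pos bound t z<s

ascents-per-block-≤ : SCardBound → ∀ j {t} → 1 ≤ t → t < modulus j → ∀ k →
                      count (ascent? t ∘ (k * 2 ^ suc j +_)) (2 ^ suc j) ≤ 2 ^ j + suc t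
ascents-per-block-≤ bound j {t} 1≤t t<M k = begin
  count (ascent? t ∘ (k * 2 ^ suc j +_)) (2 ^ suc j)  ≤⟨ ascents-per-block (suc j) split k ⟩
  count (ascent? t) L + suc t                         ≤⟨ +-monoˡ-≤ (suc t) (ascents-≤-SCard j 1≤t split) ⟩
  SCard j L + suc t                                   ≤⟨ +-monoˡ-≤ (suc t) (bound j L (m<n⇒0<n∸m t<M) (<modulus⇒≤2^[1+j]∸2 j L<M)) ⟩
  2 ^ j + suc t                                       ∎
  where
  open ≤-Reasoning
  L : ℕ
  L = modulus j ∸ t
  split : suc (L + t) ≡ 2 ^ suc j
  split = modulus-split j (<⇒≤ t<M)
  L<M : L < modulus j
  L<M = ∸-monoʳ-< 1≤t (<⇒≤ t<M)

-- Blocks of length 2^(j+1) with j = 2m(t+1) make the excess t + 1 per block negligible.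
countGT-density-pos : SCardBound → ∀ t → 1 ≤ t → DensityAtMostHalf (countGT t)
countGT-density-pos bound t 1≤t m@(suc _) _ = (2 * m + 1) * (2 * H) , λ N N₀≤N →
  subst (λ c → 2 * m * c ≤ (m + 1) * N) (sym (length-filter-applyUpTo (ascent? t) id N))
    (gt-arithmetic m (suc t) H N (count (ascent? t) N) {{m^n≢0 2 j}} (<⇒≤ (n<2^n j)) (density N) N₀≤N)
  where
  j H : ℕ
  j = 2 * m * suc t
  H = 2 ^ j
  t<M : t < modulus j
  t<M = ≤-<-trans (≤-trans (n≤1+n t) (m≤n*m (suc t) (2 * m))) (j<modulus j)
  density : ∀ N → 2 * H * count (ascent? t) N ≤ (H + suc t) * (N + 2 * H)
  density = count-periodic-density (ascent? t) (2 ^ suc j) (H + suc t) {{m^n≢0 2 (suc j)}}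
                                   (ascents-per-block-≤ bound j 1≤t t<M)

countGT-density : SCardBound → ∀ t → DensityAtMostHalf (countGT t)
countGT-density bound zero m _ = 0 , λ N _ → ≤-trans (≤-reflexive (trans (cong (2 * m *_) (countGT-0 N)) (*-zeroʳ (2 * m)))) z≤n
  where
  countGT-0 : ∀ N → countGT 0 N ≡ 0
  countGT-0 N = trans (length-filter-applyUpTo (ascent? 0) id N)
                      (count-none (ascent? 0) N (λ i _ → <-irrefl (cong w (sym (+-identityʳ i)))))
countGT-density bound t@(suc _) = countGT-density-pos bound t z<s

proposition2 : (∀ (j t : ℕ) → 1 ≤ t → t ≤ 2 ^ suc j ∸ 2 → SCard j t ≤ 2 ^ j)
    → ∀ (t : ℕ) →
      (∃[ a ] ∃[ b ] (0 < b × b < 2 * a × ∃[ N₀ ] (∀ N → N₀ ≤ N → a * N ≤ b * countGE t N)))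
      × (∀ (m : ℕ) → 1 ≤ m → ∃[ N₀ ] (∀ N → N₀ ≤ N → (2 * m) * countGT t N ≤ (m + 1) * N))
proposition2 bound t = countGE-density bound t , countGT-density bound t
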